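{- Let $\mid$ be any binary relation on $\mathbb{Z}\times\mathbb{Z}$ such that for all $a,c,d\in\mathbb{Z}$ with $a$ odd, $(a,1)\mid(c,d)$ holds if and only if $c=ad$ (its truth value on other arguments is arbitrary). Let $a,b,c\in\mathbb{Z}$. Then $ab=c$ if and only if there exists $X\in\mathbb{Z}\times\mathbb{Z}$ such that $$(1,1)\mid X,\qquad (-1,1)\mid \big(X-2(b,0)\big),\qquad \big(2(a,0)+(1,1)\big)\mid\big(X+2(c,0)\big),$$ where addition and integer scaling in $\mathbb{Z}\times\mathbb{Z}$ are componentwise. -}

module Defs where

open import Level using (Level; suc)
open import Data.Integer using (ℤ; _+_; _*_; +_; -_)
open import Data.Product using (_×_; _,_; ∃)
open import Relation.Binary.PropositionalEquality using (_≡_)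

Odd : ℤ → Set
Odd a = ∃ λ k → a ≡ (+ 2) * k + + 1

ℤ² : Set
ℤ² = ℤ × ℤ

infixl 6 _⊕_ _⊖_
infixl 7 _·_

_⊕_ : ℤ² → ℤ² → ℤ²
(x₁ , x₂) ⊕ (y₁ , y₂) = (x₁ + y₁ , x₂ + y₂)

_·_ : ℤ → ℤ² → ℤ²
k · (x₁ , x₂) = (k * x₁ , k * x₂)

_⊖_ : ℤ² → ℤ² → ℤ²
x ⊖ y = x ⊕ ((- + 1) · y)

module Submission where

-- Every divisor occurring in the theorem has the form (d , 1)
-- with d odd: d = 1, d = -1 and d = 2a+1.  For such divisors the hypothesis
-- says that (d , 1) ∣ (u , v) holds exactly when u = d·v, so the three
-- divisibility conditions on X = (x , y) become three linear equations:
--     x = y,      x - 2b = -y,      x + 2c = (2a+1)·y.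
-- If ab = c then X = (b , b) solves them.  Conversely the first equation
-- gives y = x, the second then gives 2x = 2b, hence x = b, and the third
-- becomes 2c = 2ab, hence c = ab (cancelling the factor 2 in ℤ).

open import Defs
open import Level using (Level)
open import Data.Integer using (ℤ; _*_; +_; -_; _+_)
open import Data.Integer.Properties using (*-cancelˡ-≡)
open import Data.Integer.Tactic.RingSolver using (solve-∀)
open import Data.Product using (_×_; _,_; ∃)
open import Function.Bundles using (_⇔_; mk⇔; Equivalence)
open import Relation.Binary.PropositionalEquality
  using (_≡_; refl; sym; trans; cong; module ≡-Reasoning)
open ≡-Reasoning

odd-2k+1 : ∀ k → Odd (+ 2 * k + + 1)
odd-2k+1 k = k , refl

odd-one : Odd (+ 1)
odd-one = odd-2k+1 (+ 0)

odd-minus-one : Odd (- + 1)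
odd-minus-one = odd-2k+1 (- + 1)

diagonal : ∀ x y → x ≡ + 1 * y → x ≡ y
diagonal x y x≡1y = trans x≡1y (one-unit y)
  where
  one-unit : ∀ y → + 1 * y ≡ y
  one-unit = solve-∀

-- On the diagonal, (-1,1) ∣ (x , x) - 2(b,0) reads x - 2b = -x, which
-- forces x = b after cancelling the factor 2.
antidiagonal-shift : ∀ x b →
  x + (- + 1) * (+ 2 * b) ≡ (- + 1) * (x + (- + 1) * (+ 2 * + 0)) → x ≡ b
antidiagonal-shift x b eq = *-cancelˡ-≡ (+ 2) x b (begin
  + 2 * x                                              ≡⟨ expand x b ⟩
  (x + (- + 1) * (+ 2 * b)) + x + + 2 * b              ≡⟨ cong (λ t → t + x + + 2 * b) eq ⟩
  (- + 1) * (x + (- + 1) * (+ 2 * + 0)) + x + + 2 * b  ≡⟨ collapse x b ⟩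
  + 2 * b                                              ∎)
  where
  expand : ∀ x b → + 2 * x ≡ (x + (- + 1) * (+ 2 * b)) + x + + 2 * b
  expand = solve-∀
  collapse : ∀ x b → (- + 1) * (x + (- + 1) * (+ 2 * + 0)) + x + + 2 * b ≡ + 2 * b
  collapse = solve-∀

-- With X = (b , b), (2a+1,1) ∣ X + 2(c,0) reads b + 2c = (2a+1)·b, which
-- forces ab = c after cancelling the factor 2.
odd-line-shift : ∀ a b c →
  b + + 2 * c ≡ (+ 2 * a + + 1) * (b + + 2 * + 0) → a * b ≡ c
odd-line-shift a b c eq = sym (*-cancelˡ-≡ (+ 2) c (a * b) (begin
  + 2 * c                                          ≡⟨ expand b c ⟩
  (b + + 2 * c) + (- + 1) * b                      ≡⟨ cong (λ t → t + (- + 1) * b) eq ⟩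
  (+ 2 * a + + 1) * (b + + 2 * + 0) + (- + 1) * b  ≡⟨ collapse a b ⟩
  + 2 * (a * b)                                    ∎))
  where
  expand : ∀ b c → + 2 * c ≡ (b + + 2 * c) + (- + 1) * b
  expand = solve-∀
  collapse : ∀ a b → (+ 2 * a + + 1) * (b + + 2 * + 0) + (- + 1) * b ≡ + 2 * (a * b)
  collapse = solve-∀

witness-diagonal : ∀ b → b ≡ + 1 * b
witness-diagonal = solve-∀

witness-antidiagonal : ∀ b → b + (- + 1) * (+ 2 * b) ≡ (- + 1) * (b + (- + 1) * (+ 2 * + 0))
witness-antidiagonal = solve-∀

witness-odd-line : ∀ a b → b + + 2 * (a * b) ≡ (+ 2 * a + + 1) * (b + + 2 * + 0)
witness-odd-line = solve-∀

mainTheorem8 : ∀ {ℓ : Level} (_∣_ : ℤ² → ℤ² → Set ℓ) →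
    (∀ a c d → Odd a → (((a , + 1) ∣ (c , d)) ⇔ (c ≡ a * d))) →
    ∀ a b c →
    (a * b ≡ c) ⇔ (∃ λ (X : ℤ²) →
    ((+ 1 , + 1) ∣ X) ×
    ((- + 1 , + 1) ∣ (X ⊖ (+ 2) · (b , + 0))) ×
    (((+ 2) · (a , + 0) ⊕ (+ 1 , + 1)) ∣ (X ⊕ (+ 2) · (c , + 0))))
mainTheorem8 {ℓ} _∣_ onLine a b c = mk⇔ witness solve
  where
  open Equivalence
  Certificate : ℤ² → Set ℓ
  Certificate X = ((+ 1 , + 1) ∣ X) ×
    ((- + 1 , + 1) ∣ (X ⊖ (+ 2) · (b , + 0))) ×
    (((+ 2) · (a , + 0) ⊕ (+ 1 , + 1)) ∣ (X ⊕ (+ 2) · (c , + 0)))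

  odd-a : Odd (+ 2 * a + + 1)
  odd-a = odd-2k+1 a

  witness : a * b ≡ c → ∃ Certificate
  witness refl = (b , b)
    , from (onLine _ _ _ odd-one) (witness-diagonal b)
    , from (onLine _ _ _ odd-minus-one) (witness-antidiagonal b)
    , from (onLine _ _ _ odd-a) (witness-odd-line a b)

  solve : ∃ Certificate → a * b ≡ c
  solve ((x , y) , on-diag , on-antidiag , on-odd)
    with diagonal x y (to (onLine _ _ _ odd-one) on-diag)
  ... | refl with antidiagonal-shift x b (to (onLine _ _ _ odd-minus-one) on-antidiag)
  ... | refl = odd-line-shift a b c (to (onLine _ _ _ odd-a) on-odd)
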